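{- Let $A$ and $B$ be finite sets of UTVPI constraints with integer constants, such that $A\wedge B$ is satisfiable over $\mathbb Q$ but unsatisfiable over $\mathbb Z$. Let $A',B'$ be their difference-logic encodings and let $C$ be a cycle of total weight $0$ in the constraint graph $G(A'\wedge B')$ (each edge labelled as coming from $A'$ or from $B'$; write $C_A$, $C_B$ for the $A'$- and $B'$-edges of $C$) that contains, each exactly once, the two vertices $x_i^+$ and $x_i^-$ of some variable $x_i$, such that the weight of the path $\pi$ from $x_i^-$ to $x_i^+$ along $C$ is odd, say $2k+1$. Suppose $x_i$ occurs in $A$ but not in $B$, and that all edges of $\pi$ belong to $C_A$. Let $\overline C$ be the cycle obtained from $C$ by replacing $\pi$ with the single edge $x_i^-\xrightarrow{2k} x_i^+$ (i.e. the constraint $(0\le x_i^+-x_i^-+2k)$), labelled as an $A'$-edge. Let $I'$ be the difference-logic interpolant computed from $\overline C$, namely $I'=\bot$ if all edges of $\overline C$ are $A'$-edges, and otherwise the conjunction of the summary constraints of the maximal $A'$-paths of $\overline C$; and let $I=\Upsilon(I')$. Then $I$ is an interpolant for $(A,B)$ over the integers.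
   Context: A UTVPI constraint is $(0\le a x + b y + k)$ with $a,b\in\{ -1,0,1\}$. For each variable $x$ there are difference-logic variables $x^+,x^-$, with $\Upsilon(x^+)=x$, $\Upsilon(x^-)=-x$; write $v(x)=x^+$, $v(-x)=x^-$ for signed variables. Encoding: $(0\le s_1+s_2+k)$ with $s_1,s_2$ signed occurrences of distinct variables becomes $(0\le v(s_1)-v(-s_2)+k)$ and $(0\le v(s_2)-v(-s_1)+k)$; $(0\le s+k)$ becomes $(0\le v(s)-v(-s)+2k)$. $\Upsilon(0\le v-u+k)=(0\le\Upsilon(v)-\Upsilon(u)+k)$, extended to conjunctions, with $\Upsilon(\bot)=\bot$. The graph has an edge $u\xrightarrow{c}v$ per constraint $(0\le v-u+c)$. A maximal $A'$-path of a cycle is a maximal path $u_1\xrightarrow{c_1}\cdots\xrightarrow{c_{n-1}}u_n$ of consecutive $A'$-edges preceded and followed in the cycle by $B'$-edges; its summary constraint is $(0\le u_n-u_1+\sum c_j)$. An interpolant for $(A,B)$ over the integers is a formula $I$ with $A\models I$ and $I\wedge B$ unsatisfiable (variables ranging over $\mathbb Z$), and every variable of $I$ occurring in both $A$ and $B$. -}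

module Defs where

open import Data.Nat as ℕ using (ℕ; suc)
open import Data.Integer as ℤ using (ℤ; +_)
open import Data.Rational as ℚ using (ℚ; 0ℚ)
open import Data.List using (List; []; _∷_; _++_; [_]; concatMap; filter; length)
open import Data.List.Relation.Unary.All using (All)
open import Data.List.Relation.Unary.Any using (Any)
open import Data.List.Membership.Propositional using (_∈_)
open import Data.Product using (_×_; _,_)
open import Data.Maybe using (Maybe; just; nothing)
open import Data.Empty using (⊥)
open import Relation.Nullary using (¬_; Dec; yes; no)
open import Relation.Binary.PropositionalEquality using (_≡_; _≢_; refl; cong)

data SVar : Set where
  +v : ℕ → SVar
  -v : ℕ → SVar

idx : SVar → ℕ
idx (+v i) = i
idx (-v i) = i

negS : SVar → SVar
negS (+v i) = -v i
negS (-v i) = +v i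

-- UTVPI constraints (0 ≤ a x + b y + k), a,b ∈ {-1,0,1}, not both 0.
--   two s₁ s₂ _ k  :  (0 ≤ s₁ + s₂ + k), s₁, s₂ on distinct variables
--   one s k        :  (0 ≤ s + k)

data UTVPI : Set where
  two : (s₁ s₂ : SVar) → idx s₁ ≢ idx s₂ → ℤ → UTVPI
  one : (s : SVar) → ℤ → UTVPI

varsU : UTVPI → List ℕ
varsU (two s₁ s₂ _ k) = idx s₁ ∷ idx s₂ ∷ []
varsU (one s k) = idx s ∷ []

OccursIn : ℕ → List UTVPI → Set
OccursIn i A = Any (λ c → i ∈ varsU c) A

valℤ : (ℕ → ℤ) → SVar → ℤ
valℤ ρ (+v i) = ρ i
valℤ ρ (-v i) = ℤ.- ρ i

Holdsℤ : (ℕ → ℤ) → UTVPI → Set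
Holdsℤ ρ (two s₁ s₂ _ k) = + 0 ℤ.≤ (valℤ ρ s₁ ℤ.+ valℤ ρ s₂) ℤ.+ k
Holdsℤ ρ (one s k) = + 0 ℤ.≤ valℤ ρ s ℤ.+ k

valℚ : (ℕ → ℚ) → SVar → ℚ
valℚ ρ (+v i) = ρ i
valℚ ρ (-v i) = ℚ.- ρ i

Holdsℚ : (ℕ → ℚ) → UTVPI → Set
Holdsℚ ρ (two s₁ s₂ _ k) = 0ℚ ℚ.≤ (valℚ ρ s₁ ℚ.+ valℚ ρ s₂) ℚ.+ (k ℚ./ 1)
Holdsℚ ρ (one s k) = 0ℚ ℚ.≤ valℚ ρ s ℚ.+ (k ℚ./ 1)

SatOverℚ : List UTVPI → Set
SatOverℚ A = Data.Product.∃ λ (ρ : ℕ → ℚ) → All (Holdsℚ ρ) A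

SatOverℤ : List UTVPI → Set
SatOverℤ A = Data.Product.∃ λ (ρ : ℕ → ℤ) → All (Holdsℤ ρ) A

data DVar : Set where
  _⁺ : ℕ → DVar
  _⁻ : ℕ → DVar

_≟D_ : (u w : DVar) → Dec (u ≡ w)
(i ⁺) ≟D (j ⁺) with i ℕ.≟ j
... | yes refl = yes refl
... | no ne = no λ { refl → ne refl }
(i ⁺) ≟D (j ⁻) = no λ ()
(i ⁻) ≟D (j ⁺) = no λ ()
(i ⁻) ≟D (j ⁻) with i ℕ.≟ j
... | yes refl = yes refl
... | no ne = no λ { refl → ne refl }

v : SVar → DVar
v (+v i) = i ⁺
v (-v i) = i ⁻

Υv : DVar → SVar
Υv (i ⁺) = +v i
Υv (i ⁻) = -v i

-- Difference constraint (0 ≤ to − from + w); it is the graph edge from →w to.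
record DC : Set where
  constructor dc
  field
    from : DVar
    to   : DVar
    w    : ℤ
open DC public

encode : UTVPI → List DC
encode (two s₁ s₂ _ k) = dc (v (negS s₂)) (v s₁) k ∷ dc (v (negS s₁)) (v s₂) k ∷ []
encode (one s k) = dc (v (negS s)) (v s) (+ 2 ℤ.* k) ∷ []

encodeAll : List UTVPI → List DC
encodeAll = concatMap encode

data Label : Set where
  lA lB : Label

record LEdge : Set where
  constructor le
  field
    lab  : Label
    edge : DC
open LEdge public

InGraph : List DC → List DC → LEdge → Set
InGraph A' B' (le lA e) = e ∈ A'
InGraph A' B' (le lB e) = e ∈ B'

data Path : DVar → List LEdge → DVar → Set where
  [] : ∀ {u} → Path u [] u
  _∷_ : ∀ {w} {e : LEdge} {es} → Path (to (edge e)) es w → Path (from (edge e)) (e ∷ es) w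

weight : List LEdge → ℤ
weight [] = + 0
weight (e ∷ es) = w (edge e) ℤ.+ weight es

-- number of edges of a cycle leaving vertex u = number of occurrences of u on the cycle
occurrences : DVar → List LEdge → ℕ
occurrences u es = length (filter (λ e → from (edge e) ≟D u) es)

-- Difference-logic interpolant computed from a cycle (given as a closed
-- list of labelled edges, read cyclically).

rotateToB : List LEdge → List LEdge → Maybe (List LEdge)
rotateToB acc [] = nothing
rotateToB acc (le lA e ∷ es) = rotateToB (acc ++ [ le lA e ]) es
rotateToB acc (le lB e ∷ es) = just (le lB e ∷ es ++ acc)

mutual
  summaries : List LEdge → List DC
  summaries [] = []
  summaries (le lB e ∷ es) = summaries es
  summaries (le lA e ∷ es) = run (from e) (to e) (w e) es

  -- currently inside an A'-path from s to t with accumulated weight c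
  run : DVar → DVar → ℤ → List LEdge → List DC
  run s t c [] = dc s t c ∷ []
  run s t c (le lA e ∷ es) = run s (to e) (c ℤ.+ w e) es
  run s t c (le lB e ∷ es) = dc s t c ∷ summaries es

-- I' : nothing stands for ⊥, just cs for the conjunction of cs
dlInterpolant : List LEdge → Maybe (List DC)
dlInterpolant C with rotateToB [] C
... | nothing = nothing
... | just C' = just (summaries C')

record TC : Set where
  constructor tc
  field
    pos-s : SVar
    neg-s : SVar
    cst   : ℤ

data Formula : Set where
  falseF : Formula
  conjF  : List TC → Formula

ΥDC : DC → TC
ΥDC (dc u t c) = tc (Υv t) (Υv u) c

Υ : Maybe (List DC) → Formula
Υ nothing = falseF
Υ (just cs) = conjF (Data.List.map ΥDC cs)

HoldsTC : (ℕ → ℤ) → TC → Set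
HoldsTC ρ (tc s₁ s₂ k) = + 0 ℤ.≤ (valℤ ρ s₁ ℤ.- valℤ ρ s₂) ℤ.+ k

HoldsF : (ℕ → ℤ) → Formula → Set
HoldsF ρ falseF = ⊥
HoldsF ρ (conjF cs) = All (HoldsTC ρ) cs

varsF : Formula → List ℕ
varsF falseF = []
varsF (conjF cs) = concatMap (λ { (tc s₁ s₂ k) → idx s₁ ∷ idx s₂ ∷ [] }) cs

record IsIntInterpolant (A B : List UTVPI) (I : Formula) : Set where
  field
    entailed : ∀ (ρ : ℕ → ℤ) → All (Holdsℤ ρ) A → HoldsF ρ I
    inconsistent : ∀ (ρ : ℕ → ℤ) → HoldsF ρ I → All (Holdsℤ ρ) B → ⊥
    shared : ∀ i → i ∈ varsF I → OccursIn i A × OccursIn i B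

-- Every edge of π comes from A', so over ℤ the formula A entails the summary of π,
-- 2 x_i + (2k + 1) ≥ 0; by integrality this tightens to 2 x_i + 2k ≥ 0, the constraint
-- of the new edge x_i⁻ →2k x_i⁺. Since C has weight 0 and π weight 2k + 1, the cycle
-- C̄ has weight -1. For a negative cycle whose edges are each entailed by their own
-- side, the usual argument applies: A entails the summary of every maximal A'-path,
-- and these summaries together with the B'-edges telescope to 0 ≤ weight C̄ < 0.
-- Each endpoint of a summary is also an endpoint of a B'-edge, so its variable is shared.
module Submission where

open import Defs
open import Data.Nat using (ℕ; z≤n)
open import Data.Integer using (ℤ; +_; -[1+_]; _+_; _*_; _-_; -_; _≤_; _<_; +≤+; -<+)
import Data.Integer.Properties as ℤ
open import Data.Integer.Tactic.RingSolver using (solve-∀)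
open import Data.List using (List; []; _∷_; _++_; [_]; map)
open import Data.List.Properties using (++-assoc; ++-identityʳ)
open import Data.List.Relation.Unary.All as All using (All; []; _∷_)
import Data.List.Relation.Unary.All.Properties as All
import Data.List.Relation.Unary.Any as Any
open import Data.List.Relation.Unary.Any using (here; there)
open import Data.List.Membership.Propositional using (_∈_)
open import Data.List.Membership.Propositional.Properties using (∈-concatMap⁻)
open import Data.Product using (_×_; ∃; ∃₂; _,_; proj₁; proj₂)
open import Data.Maybe using (just; nothing)
open import Function using (_∘_)
open import Relation.Nullary using (¬_)
open import Relation.Binary.PropositionalEquality
  using (_≡_; refl; sym; trans; cong; cong₂; subst; module ≡-Reasoning)

value : (ℕ → ℤ) → DVar → ℤ
value r x = valℤ r (Υv x)

var : DVar → ℕ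
var x = idx (Υv x)

Bound : (ℕ → ℤ) → DVar → DVar → ℤ → Set
Bound r u t c = + 0 ≤ (value r t - value r u) + c

-- Definitionally equal to HoldsTC r (ΥDC d).
HoldsDC : (ℕ → ℤ) → DC → Set
HoldsDC r d = Bound r (from d) (to d) (w d)

bound-refl : ∀ r u → Bound r u u (+ 0)
bound-refl r u = subst (+ 0 ≤_) (x≡[a-a]+x (value r u) (+ 0)) ℤ.≤-refl
  where
  x≡[a-a]+x : ∀ a x → x ≡ (a - a) + x
  x≡[a-a]+x = solve-∀

bound-trans : ∀ r u m t {c e} → Bound r u m c → Bound r m t e → Bound r u t (c + e)
bound-trans r u m t {c} {e} b₁ b₂ =
  subst (+ 0 ≤_) (telescope (value r u) (value r m) (value r t) c e) (ℤ.+-mono-≤ b₁ b₂)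
  where
  telescope : ∀ a b d c e → ((b - a) + c) + ((d - b) + e) ≡ (d - a) + (c + e)
  telescope = solve-∀

bound-closed : ∀ r u {c} → Bound r u u c → + 0 ≤ c
bound-closed r u {c} b = subst (+ 0 ≤_) ([a-a]+x≡x (value r u) c) b
  where
  [a-a]+x≡x : ∀ a x → (a - a) + x ≡ x
  [a-a]+x≡x = solve-∀

0≤n+n+1⇒0≤n+n : ∀ n → + 0 ≤ (n + n) + + 1 → + 0 ≤ n + n
0≤n+n+1⇒0≤n+n (+ _)    _  = +≤+ z≤n
0≤n+n+1⇒0≤n+n -[1+ _ ] ()

bound-tighten : ∀ r i k → Bound r (i ⁻) (i ⁺) (+ 2 * k + + 1) → Bound r (i ⁻) (i ⁺) (+ 2 * k)
bound-tighten r i k b =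
  subst (+ 0 ≤_) (sym (double (r i) k))
    (0≤n+n+1⇒0≤n+n (r i + k) (subst (+ 0 ≤_) (double+1 (r i) k) b))
  where
  double : ∀ a k → (a - - a) + + 2 * k ≡ (a + k) + (a + k)
  double = solve-∀
  double+1 : ∀ a k → (a - - a) + (+ 2 * k + + 1) ≡ ((a + k) + (a + k)) + + 1
  double+1 = solve-∀

_⊨_ : List UTVPI → DC → Set
A ⊨ d = ∀ r → All (Holdsℤ r) A → HoldsDC r d

VarsIn : List UTVPI → DC → Set
VarsIn A d = OccursIn (var (from d)) A × OccursIn (var (to d)) A

Justified : List UTVPI → DC → Set
Justified A d = A ⊨ d × VarsIn A d

value-v : ∀ r s → value r (v s) ≡ valℤ r s
value-v r (+v i) = refl
value-v r (-v i) = refl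

value-v-negS : ∀ r s → value r (v (negS s)) ≡ - valℤ r s
value-v-negS r (+v i) = refl
value-v-negS r (-v i) = sym (ℤ.neg-involutive (r i))

var-v : ∀ s → var (v s) ≡ idx s
var-v (+v i) = refl
var-v (-v i) = refl

var-v-negS : ∀ s → var (v (negS s)) ≡ idx s
var-v-negS (+v i) = refl
var-v-negS (-v i) = refl

bound-of-sum : ∀ r s₁ s₂ k → + 0 ≤ (valℤ r s₁ + valℤ r s₂) + k → Bound r (v (negS s₂)) (v s₁) k
bound-of-sum r s₁ s₂ k = subst (+ 0 ≤_) (begin
  (valℤ r s₁ + valℤ r s₂) + k                         ≡⟨ a+b≡a--b (valℤ r s₁) (valℤ r s₂) k ⟩
  (valℤ r s₁ - - valℤ r s₂) + k                       ≡⟨ cong₂ (λ a b → (a - b) + k)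
                                                           (sym (value-v r s₁)) (sym (value-v-negS r s₂)) ⟩
  (value r (v s₁) - value r (v (negS s₂))) + k        ∎)
  where
  open ≡-Reasoning
  a+b≡a--b : ∀ a b k → (a + b) + k ≡ (a - - b) + k
  a+b≡a--b = solve-∀

encode-sound : ∀ r c → Holdsℤ r c → All (HoldsDC r) (encode c)
encode-sound r (two s₁ s₂ _ k) h =
    bound-of-sum r s₁ s₂ k h
  ∷ bound-of-sum r s₂ s₁ k (subst (λ z → + 0 ≤ z + k) (ℤ.+-comm (valℤ r s₁) (valℤ r s₂)) h)
  ∷ []
encode-sound r (one s k) h =
  bound-of-sum r s s (+ 2 * k) (subst (+ 0 ≤_) (double (valℤ r s) k) (ℤ.+-mono-≤ h h)) ∷ []
  where
  double : ∀ a k → (a + k) + (a + k) ≡ (a + a) + + 2 * k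
  double = solve-∀

encode-local : ∀ c → All (λ d → var (from d) ∈ varsU c × var (to d) ∈ varsU c) (encode c)
encode-local (two s₁ s₂ _ _) =
    (there (here (var-v-negS s₂)) , here (var-v s₁))
  ∷ (here (var-v-negS s₁) , there (here (var-v s₂)))
  ∷ []
encode-local (one s _) = (here (var-v-negS s) , here (var-v s)) ∷ []

encodeAll-justified : ∀ A {d} → d ∈ encodeAll A → Justified A d
encodeAll-justified A {d} d∈ =
    (λ r hA → All.lookup (All.concat⁺ (All.map⁺ (All.map (encode-sound r _) hA))) d∈)
  , Any.map (proj₁ ∘ local) origin
  , Any.map (proj₂ ∘ local) origin
  where
  origin : Any.Any (λ c → d ∈ encode c) A
  origin = ∈-concatMap⁻ encode {xs = A} d∈
  local : ∀ {c} → d ∈ encode c → var (from d) ∈ varsU c × var (to d) ∈ varsU c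
  local {c} = All.lookup (encode-local c)

sideOf : Label → List UTVPI → List UTVPI → List UTVPI
sideOf lA A B = A
sideOf lB A B = B

JustifiedEdge : List UTVPI → List UTVPI → LEdge → Set
JustifiedEdge A B e = Justified (sideOf (lab e) A B) (edge e)

inGraph-justified : ∀ A B e → InGraph (encodeAll A) (encodeAll B) e → JustifiedEdge A B e
inGraph-justified A B (le lA d) = encodeAll-justified A
inGraph-justified A B (le lB d) = encodeAll-justified B

HoldsIfLabelled : Label → (ℕ → ℤ) → LEdge → Set
HoldsIfLabelled ℓ r e = lab e ≡ ℓ → HoldsDC r (edge e)

labelled-edges-hold : ∀ {A B r xs} ℓ → All (Holdsℤ r) (sideOf ℓ A B) → All (JustifiedEdge A B) xs
                    → All (HoldsIfLabelled ℓ r) xs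
labelled-edges-hold {r = r} ℓ h = All.map λ { (entails , _) refl → entails r h }

A-edges-hold : ∀ {A B r xs} → All (Holdsℤ r) A → All (JustifiedEdge A B) xs
             → All (λ e → lab e ≡ lA) xs → All (HoldsDC r ∘ edge) xs
A-edges-hold hA js labels = All.zipWith (λ (h , l) → h l) (labelled-edges-hold lA hA js , labels)

path-++ : ∀ {u m t xs ys} → Path u xs m → Path m ys t → Path u (xs ++ ys) t
path-++ []       q = q
path-++ (_∷_ p) q = _∷_ (path-++ p q)

path-split : ∀ xs {ys u t} → Path u (xs ++ ys) t → ∃ λ m → Path u xs m × Path m ys t
path-split []       p        = _ , [] , p
path-split (_ ∷ xs) (_∷_ p) with path-split xs p
... | m , p₁ , p₂ = m , _∷_ p₁ , p₂

path-rotate : ∀ xs {ys u} → Path u (xs ++ ys) u → ∃ λ m → Path m (ys ++ xs) m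
path-rotate xs p with path-split xs p
... | m , p₁ , p₂ = m , path-++ p₂ p₁

weight-++ : ∀ xs ys → weight (xs ++ ys) ≡ weight xs + weight ys
weight-++ []       ys = sym (ℤ.+-identityˡ (weight ys))
weight-++ (x ∷ xs) ys =
  trans (cong (λ z → w (edge x) + z) (weight-++ xs ys)) (sym (ℤ.+-assoc (w (edge x)) (weight xs) (weight ys)))

weight-rotate : ∀ xs ys → weight (ys ++ xs) ≡ weight (xs ++ ys)
weight-rotate xs ys =
  trans (weight-++ ys xs) (trans (ℤ.+-comm (weight ys) (weight xs)) (sym (weight-++ xs ys)))

All-rotate : ∀ {P : LEdge → Set} xs {ys} → All P (xs ++ ys) → All P (ys ++ xs)
All-rotate xs ps with All.++⁻ xs ps
... | pxs , pys = All.++⁺ pys pxs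

path-bound : ∀ r {u xs t} → Path u xs t → All (HoldsDC r ∘ edge) xs → Bound r u t (weight xs)
path-bound r {u} []                  []       = bound-refl r u
path-bound r {t = t} (_∷_ {e = e} p) (h ∷ hs) =
  bound-trans r (from (edge e)) (to (edge e)) t h (path-bound r p hs)

rotateToB-nothing : ∀ acc xs → rotateToB acc xs ≡ nothing → All (λ e → lab e ≡ lA) xs
rotateToB-nothing acc []             _  = []
rotateToB-nothing acc (le lA e ∷ es) eq = refl ∷ rotateToB-nothing (acc ++ [ le lA e ]) es eq
rotateToB-nothing acc (le lB e ∷ es) ()

rotateToB-just : ∀ acc xs {C'} → rotateToB acc xs ≡ just C'
               → ∃₂ λ p d → ∃ λ s → xs ≡ p ++ le lB d ∷ s × C' ≡ le lB d ∷ s ++ acc ++ p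
rotateToB-just acc []             ()
rotateToB-just acc (le lA e ∷ es) eq with rotateToB-just (acc ++ [ le lA e ]) es eq
... | p , d , s , refl , refl =
  le lA e ∷ p , d , s , refl , cong (λ ys → le lB d ∷ s ++ ys) (++-assoc acc [ le lA e ] p)
rotateToB-just acc (le lB d ∷ s)  refl =
  [] , d , s , refl , cong (λ ys → le lB d ∷ s ++ ys) (sym (++-identityʳ acc))

mutual
  summaries-hold : ∀ {r u xs t} → Path u xs t → All (HoldsIfLabelled lA r) xs
                 → All (HoldsDC r) (summaries xs)
  summaries-hold []                               []       = []
  summaries-hold {xs = le lB d ∷ _} (_∷_ p) (_ ∷ hs) = summaries-hold p hs
  summaries-hold {xs = le lA d ∷ _} (_∷_ p) (h ∷ hs) = run-holds p (h refl) hs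

  run-holds : ∀ {r s t c xs t'} → Path t xs t' → Bound r s t c → All (HoldsIfLabelled lA r) xs
            → All (HoldsDC r) (run s t c xs)
  run-holds []       b [] = b ∷ []
  run-holds {r} {s} {t} {xs = le lA d ∷ _} (_∷_ p) b (h ∷ hs) =
    run-holds p (bound-trans r s t (to d) b (h refl)) hs
  run-holds {xs = le lB d ∷ _} (_∷_ p) b (_ ∷ hs) = b ∷ summaries-hold p hs

mutual
  summaries-bound : ∀ {r u xs t} → Path u xs t → All (HoldsDC r) (summaries xs)
                  → All (HoldsIfLabelled lB r) xs → Bound r u t (weight xs)
  summaries-bound {r} {u} [] _ [] = bound-refl r u
  summaries-bound {r} {xs = le lB d ∷ _} {t} (_∷_ p) hs (h ∷ hbs) =
    bound-trans r (from d) (to d) t (h refl) (summaries-bound p hs hbs)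
  summaries-bound {xs = le lA d ∷ _} (_∷_ p) hs (_ ∷ hbs) = run-bound p hs hbs

  run-bound : ∀ {r s t c xs t'} → Path t xs t' → All (HoldsDC r) (run s t c xs)
            → All (HoldsIfLabelled lB r) xs → Bound r s t' (c + weight xs)
  run-bound {r} {s} {t} {c} [] (b ∷ []) [] =
    subst (Bound r s t) (sym (ℤ.+-identityʳ c)) b
  run-bound {r} {s} {c = c} {le lA d ∷ es} {t'} (_∷_ p) hs (_ ∷ hbs) =
    subst (Bound r s t') (ℤ.+-assoc c (w d) (weight es)) (run-bound p hs hbs)
  run-bound {r} {s} {t} {xs = le lB d ∷ _} {t'} (_∷_ p) (b ∷ hs) (h ∷ hbs) =
    bound-trans r s t t' b (bound-trans r t (to d) t' (h refl) (summaries-bound p hs hbs))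

module _ (A B : List UTVPI) where

  Shared : DVar → Set
  Shared x = OccursIn (var x) A × OccursIn (var x) B

  SharedEnds : DC → Set
  SharedEnds d = Shared (from d) × Shared (to d)

  mutual
    summaries-shared : ∀ {u xs t} → Path u xs t → OccursIn (var u) B → OccursIn (var t) B
                     → All (JustifiedEdge A B) xs → All SharedEnds (summaries xs)
    summaries-shared [] _ _ [] = []
    summaries-shared {xs = le lB d ∷ _} (_∷_ p) _ inB ((_ , _ , toB) ∷ js) =
      summaries-shared p toB inB js
    summaries-shared {xs = le lA d ∷ _} (_∷_ p) fromB inB ((_ , fromA , toA) ∷ js) =
      run-shared p (fromA , fromB) toA inB js

    run-shared : ∀ {s t c xs t'} → Path t xs t' → Shared s → OccursIn (var t) A
               → OccursIn (var t') B → All (JustifiedEdge A B) xs → All SharedEnds (run s t c xs)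
    run-shared [] sh tA tB [] = (sh , tA , tB) ∷ []
    run-shared {xs = le lA d ∷ _} (_∷_ p) sh _ inB ((_ , _ , toA) ∷ js) = run-shared p sh toA inB js
    run-shared {xs = le lB d ∷ _} (_∷_ p) sh tA inB ((_ , fromB , toB) ∷ js) =
      (sh , tA , fromB) ∷ summaries-shared p toB inB js

  varsF-shared : ∀ ds → All SharedEnds ds → ∀ i → i ∈ varsF (conjF (map ΥDC ds))
               → OccursIn i A × OccursIn i B
  varsF-shared (d ∷ ds) ((_ , sh) ∷ _)  i (here refl)         = sh
  varsF-shared (d ∷ ds) ((sh , _) ∷ _)  i (there (here refl)) = sh
  varsF-shared (d ∷ ds) (_ ∷ shs)       i (there (there m))   = varsF-shared ds shs i m

startingWithB-interpolant : ∀ {A B u d s} → Path u (le lB d ∷ s) u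
                          → All (JustifiedEdge A B) (le lB d ∷ s) → weight (le lB d ∷ s) < + 0
                          → IsIntInterpolant A B (Υ (just (summaries (le lB d ∷ s))))
startingWithB-interpolant {A} {B} {d = d} p@(_∷_ _) js@((_ , fromB , _) ∷ _) negative = record
  { entailed     = λ r hA → All.map⁺ (summaries-hold p (labelled-edges-hold lA hA js))
  ; inconsistent = λ r hI hB →
      ℤ.<⇒≱ negative (bound-closed r (from d) (summaries-bound p (All.map⁻ hI) (labelled-edges-hold lB hB js)))
  ; shared       = varsF-shared A B _ (summaries-shared A B p fromB fromB js)
  }

negativeCycle-interpolant : ∀ {A B u} C → Path u C u → All (JustifiedEdge A B) C → weight C < + 0
                          → IsIntInterpolant A B (Υ (dlInterpolant C))
negativeCycle-interpolant {u = u} C p js negative with rotateToB [] C in eq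
... | nothing = record
  { entailed     = λ r hA →
      ℤ.<⇒≱ negative (bound-closed r u (path-bound r p (A-edges-hold hA js (rotateToB-nothing [] C eq))))
  ; inconsistent = λ _ ()
  ; shared       = λ _ ()
  }
... | just C' with rotateToB-just [] C eq
... | q , d , s , refl , refl =
  startingWithB-interpolant (proj₂ (path-rotate q p)) (All-rotate q js)
    (subst (_< + 0) (sym (weight-rotate q (le lB d ∷ s))) negative)

weight-tightened : ∀ {wπ wρ} k → wπ ≡ + 2 * k + + 1 → wπ + wρ ≡ + 0 → + 2 * k + wρ ≡ -[1+ 0 ]
weight-tightened {wρ = wρ} k refl cycle =
  trans (shift k wρ) (cong (_+ -[1+ 0 ]) cycle)
  where
  shift : ∀ k x → + 2 * k + x ≡ ((+ 2 * k + + 1) + x) + -[1+ 0 ]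
  shift = solve-∀

mainTheorem10 : (A B : List UTVPI) → SatOverℚ (A ++ B) → ¬ SatOverℤ (A ++ B)
    → (i : ℕ) (k : ℤ) (π ρ : List LEdge)
    → All (InGraph (encodeAll A) (encodeAll B)) (π ++ ρ)
    → Path (i ⁻) π (i ⁺) → Path (i ⁺) ρ (i ⁻)
    → weight (π ++ ρ) ≡ + 0
    → occurrences (i ⁺) (π ++ ρ) ≡ 1 → occurrences (i ⁻) (π ++ ρ) ≡ 1
    → weight π ≡ + 2 * k + + 1
    → OccursIn i A → ¬ OccursIn i B
    → All (λ e → lab e ≡ lA) π
    → IsIntInterpolant A B
    (Υ (dlInterpolant (le lA (dc (i ⁻) (i ⁺) (+ 2 * k)) ∷ ρ)))
mainTheorem10 A B _ _ i k π ρ inGraph pπ pρ cycle _ _ wπ iA _ πA =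
  negativeCycle-interpolant (le lA (dc (i ⁻) (i ⁺) (+ 2 * k)) ∷ ρ) (_∷_ pρ)
    (tightened ∷ All.map (inGraph-justified A B _) ρ-edges)
    (subst (_< + 0) (sym (weight-tightened k wπ (trans (sym (weight-++ π ρ)) cycle))) -<+)
  where
  π-edges : All (InGraph (encodeAll A) (encodeAll B)) π
  π-edges = proj₁ (All.++⁻ π inGraph)
  ρ-edges : All (InGraph (encodeAll A) (encodeAll B)) ρ
  ρ-edges = proj₂ (All.++⁻ π inGraph)

  tightened : Justified A (dc (i ⁻) (i ⁺) (+ 2 * k))
  tightened =
      (λ r hA → bound-tighten r i k (subst (Bound r (i ⁻) (i ⁺)) wπ
        (path-bound r pπ (A-edges-hold hA (All.map (inGraph-justified A B _) π-edges) πA))))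
    , iA , iA
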